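{- There exists a universal constant $\gamma_0>0$ such that for every finite domain $X$, every linear ordering imposed on $C_{all}=2^X=\{c:X\to\{0,1\}\}$, and every linear ordering of the family $\mathcal S$ of all $C_{all}$-realizable samples that extends the ordering by cardinality (smaller samples preferred), the cost caused by the greedy matching in the consistency graph $G=(C_{all},\mathcal S,E)$ is at least $\gamma_0\cdot\log_2|C_{all}|$ $(=\gamma_0|X|)$.
   Context: A labeled example is a pair $(x,b)\in X\times\{0,1\}$; a sample is a set of labeled examples. A concept $c$ is consistent with a sample $S$ if $c(x)=b$ for all $(x,b)\in S$; $S$ is realizable by a class $C$ if some $c\in C$ is consistent with it. The consistency graph is the bipartite graph $G=(C,\mathcal S,E)$ with $E=\{(c,S): c \text{ consistent with } S\}$. Both sides are linearly ordered by preference $\succ$; the ordering on $\mathcal S$ satisfies $|S|<|S'|\Rightarrow S\succ S'$. The greedy matching is produced by: start with $M=\emptyset$; while $M$ is not maximal, let $x^*$ be the most preferred concept that is unmatched and adjacent to some unmatched sample, let $y^*$ be the most preferred unmatched sample adjacent to $x^*$, and add $\{x^*,y^*\}$ to $M$. If $S_1\succ\dots\succ S_N$ lists $\mathcal S$ and $S_k$ is the least preferred sample matched by the greedy matching, its cost is $|S_k|$. -}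

module Defs where

open import Data.Nat using (ℕ; zero; suc; _+_; _<_)
open import Data.Bool using (Bool; true; false)
open import Data.Fin using (Fin)
open import Data.Vec using (Vec; lookup; foldr)
open import Data.Product using (_×_; _,_; proj₁; proj₂; Σ; ∃)
open import Data.Sum using (_⊎_)
open import Data.List using (List; _∷_; [])
open import Data.List.Relation.Unary.Any using (Any)
open import Relation.Nullary using (¬_)
open import Relation.Binary.PropositionalEquality using (_≡_; _≢_)
open import Relation.Binary.Construct.Closure.ReflexiveTransitive using (Star)

-- Domain X = Fin n.  A concept is a function X → {0,1}, represented
-- extensionally as its table of values (so that _≡_ is concept equality).
Concept : ℕ → Set
Concept n = Vec Bool n

Example : ℕ → Set
Example n = Fin n × Bool

-- A sample is a subset of X × {0,1}, represented as its characteristic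
-- table: entry x holds (is (x,false) in S , is (x,true) in S).
Sample : ℕ → Set
Sample n = Vec (Bool × Bool) n

_∈ₛ_ : ∀ {n} → Example n → Sample n → Set
(x , false) ∈ₛ S = proj₁ (lookup S x) ≡ true
(x , true)  ∈ₛ S = proj₂ (lookup S x) ≡ true

b2n : Bool → ℕ
b2n true  = 1
b2n false = 0

size : ∀ {n} → Sample n → ℕ
size S = foldr _ (λ p acc → b2n (proj₁ p) + b2n (proj₂ p) + acc) 0 S

Consistent : ∀ {n} → Concept n → Sample n → Set
Consistent c S = ∀ x b → (x , b) ∈ₛ S → lookup c x ≡ b

Realizable : ∀ {n} → Sample n → Set
Realizable S = ∃ λ c → Consistent c S

-- A strict linear order on the elements of A satisfying P
-- (x ≺ y reads "x is strictly preferred to y").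
record LinearOrderOn {A : Set} (P : A → Set) (_≺_ : A → A → Set) : Set where
  field
    irrefl  : ∀ {x} → P x → ¬ (x ≺ x)
    trans   : ∀ {x y z} → P x → P y → P z → x ≺ y → y ≺ z → x ≺ z
    connex  : ∀ {x y} → P x → P y → x ≢ y → (x ≺ y) ⊎ (y ≺ x)

-- Matchings in the consistency graph G = (C_all, S, E): lists of edges.
-- (Sample vertices are the realizable samples; an edge (c,S) requires
-- Consistent c S, which already forces S to be realizable.)
Matching : ℕ → Set
Matching n = List (Concept n × Sample n)

CMatched : ∀ {n} → Matching n → Concept n → Set
CMatched M c = Any (λ e → proj₁ e ≡ c) M

SMatched : ∀ {n} → Matching n → Sample n → Set
SMatched M S = Any (λ e → proj₂ e ≡ S) M

Candidate : ∀ {n} → Matching n → Concept n → Set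
Candidate M c = ¬ CMatched M c × ∃ λ S → ¬ SMatched M S × Consistent c S

Maximal : ∀ {n} → Matching n → Set
Maximal M = ∀ c S → ¬ CMatched M c → ¬ SMatched M S → ¬ Consistent c S

module Greedy {n : ℕ}
  (_≺c_ : Concept n → Concept n → Set)
  (_≺s_ : Sample n → Sample n → Set) where

  data Step : Matching n → Matching n → Set where
    step : ∀ {M} c S →
           Candidate M c →
           (∀ c′ → c′ ≺c c → ¬ Candidate M c′) →
           ¬ SMatched M S → Consistent c S →
           (∀ S′ → S′ ≺s S → Consistent c S′ → SMatched M S′) →
           Step M ((c , S) ∷ M)

  GreedyMatching : Matching n → Set
  GreedyMatching M = Star Step [] M × Maximal M

  LeastPreferredMatched : Matching n → Sample n → Set
  LeastPreferredMatched M S =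
    SMatched M S × (∀ S′ → SMatched M S′ → S′ ≡ S ⊎ S′ ≺s S)

{-# OPTIONS --safe #-}

-- The full sample of a concept c, which labels every point by c, is consistent with c
-- alone. A maximal matching never uses a sample twice, so it must match all 2^n concepts
-- and hence 2^n distinct samples. The preference on samples extends the order by
-- size, so every matched sample has size at most k, the size of the least preferred one.
-- At most 3^n 4^k / 2^n realizable samples have size ≤ k, so 4^n ≤ 3^n 4^k, and since
-- 3^5 · 4 < 4^5 this forces n ≤ 5k.
module Submission where

open import Defs
open import Data.Nat using (ℕ; _*_; _<_; _≤_)
open import Data.Product using (Σ; ∃; _×_; _,_)
open import Data.Unit using (⊤)

open import Data.Nat using (suc; zero; _+_; _^_; z≤n; z<s; s≤s; s≤s⁻¹)
open import Data.Nat.Properties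
open import Data.Nat.Tactic.RingSolver using (solve-∀)
open import Algebra.Properties.CommutativeSemigroup *-commutativeSemigroup using (interchange; x∙yz≈y∙xz)
open import Data.Bool using (true; false; not)
import Data.Bool.Properties as Bool
open import Data.Fin using (zero; suc)
open import Data.Vec using ([]; _∷_; replicate)
import Data.Vec.Properties as Vec
import Data.Product.Properties as Product
open import Data.Product using (proj₁; proj₂; uncurry)
open import Data.Sum using (_⊎_; inj₁; inj₂)
open import Data.List using (List; []; _∷_; [_]; _++_; map; length; cartesianProductWith)
open import Data.List.Properties using (length-++; length-map)
open import Data.List.Relation.Unary.Any as Any using (here; there; any?)
open import Data.List.Relation.Unary.Any.Properties using (map⁺; map⁻)
open import Data.List.Relation.Unary.All as All using (All; []; _∷_)
import Data.List.Relation.Unary.All.Properties as All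
open import Data.List.Relation.Unary.AllPairs using ([]; _∷_)
open import Data.List.Relation.Unary.Unique.Propositional using (Unique)
open import Data.List.Relation.Unary.Unique.Propositional.Properties using (cartesianProductWith⁺)
open import Data.List.Relation.Binary.Subset.Propositional using (_⊆_)
open import Data.List.Membership.Propositional using (_∈_; find; lose)
open import Data.List.Membership.Propositional.Properties
  using (∈-∃++; ∈-++⁺ˡ; ∈-++⁺ʳ; ∈-++⁻; ∈-map⁺)
open import Relation.Nullary using (¬_; yes; no; contradiction)
open import Relation.Nullary.Decidable using (decidable-stable)
open import Relation.Binary.Definitions using (DecidableEquality)
open import Relation.Binary.PropositionalEquality hiding ([_])
open import Relation.Binary.Construct.Closure.ReflexiveTransitive using (Star; ε; _◅_)
open import Function using (_∘_)

module _ {A : Set} where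

  ∈-++-∷⁻ : ∀ {x y : A} xs {ys} → y ∈ xs ++ x ∷ ys → y ≢ x → y ∈ xs ++ ys
  ∈-++-∷⁻ xs y∈ y≢x with ∈-++⁻ xs y∈
  ... | inj₁ y∈xs         = ∈-++⁺ˡ y∈xs
  ... | inj₂ (here y≡x)   = contradiction y≡x y≢x
  ... | inj₂ (there y∈ys) = ∈-++⁺ʳ xs y∈ys

  length-++-∷ : ∀ (xs : List A) x ys → length (xs ++ x ∷ ys) ≡ suc (length (xs ++ ys))
  length-++-∷ []       x ys = refl
  length-++-∷ (_ ∷ xs) x ys = cong suc (length-++-∷ xs x ys)

  unique∧⊆⇒length≤ : ∀ {xs ys : List A} → Unique xs → xs ⊆ ys → length xs ≤ length ys
  unique∧⊆⇒length≤ {[]}     _                  _     = z≤n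
  unique∧⊆⇒length≤ {x ∷ xs} (x≢xs ∷ xs-unique) xs⊆ys with us , vs , refl ← ∈-∃++ (xs⊆ys (here refl)) =
    subst (suc (length xs) ≤_) (sym (length-++-∷ us x vs))
      (s≤s (unique∧⊆⇒length≤ xs-unique λ y∈xs →
        ∈-++-∷⁻ us (xs⊆ys (there y∈xs)) (λ y≡x → All.lookup x≢xs y∈xs (sym y≡x))))

  length-map-++ : ∀ {B : Set} (f : B → A) xs ys → length (map f xs ++ ys) ≡ length xs + length ys
  length-map-++ f xs ys = trans (length-++ (map f xs)) (cong (_+ length ys) (length-map f xs))

module _ {A B C : Set} (f : A → B → C) where

  length-cartesianProductWith : ∀ xs ys → length (cartesianProductWith f xs ys) ≡ length xs * length ys
  length-cartesianProductWith []       ys = refl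
  length-cartesianProductWith (x ∷ xs) ys =
    trans (length-map-++ (f x) ys _) (cong (length ys +_) (length-cartesianProductWith xs ys))

module _ {A : Set} {P : A → Set} {_≺_ : A → A → Set}
         (≺-linear : LinearOrderOn P _≺_) where
  open LinearOrderOn ≺-linear renaming (trans to ≺-trans)

  _≼_ : A → A → Set
  x ≼ y = x ≡ y ⊎ x ≺ y

  ≼-or-≻ : DecidableEquality A → ∀ {x y} → P x → P y → x ≼ y ⊎ y ≺ x
  ≼-or-≻ _≟_ {x} {y} px py with x ≟ y
  ... | yes x≡y = inj₁ (inj₁ x≡y)
  ... | no  x≢y with connex px py x≢y
  ...   | inj₁ x≺y = inj₁ (inj₂ x≺y)
  ...   | inj₂ y≺x = inj₂ y≺x

  ≼-≺-trans : ∀ {x y z} → P x → P y → P z → x ≼ y → y ≺ z → x ≺ z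
  ≼-≺-trans _  _  _  (inj₁ refl) y≺z = y≺z
  ≼-≺-trans px py pz (inj₂ x≺y)  y≺z = ≺-trans px py pz x≺y y≺z

  greatest : DecidableEquality A → ∀ x xs → All P (x ∷ xs) →
             ∃ λ m → m ∈ x ∷ xs × (∀ {y} → y ∈ x ∷ xs → y ≼ m)
  greatest _≟_ x []       _          = x , here refl , λ { (here refl) → inj₁ refl }
  greatest _≟_ x (y ∷ ys) (px ∷ pys) with greatest _≟_ y ys pys
  ... | m , m∈ , m-max with ≼-or-≻ _≟_ px (All.lookup pys m∈)
  ...   | inj₁ x≼m = m , there m∈ , λ { (here refl) → x≼m ; (there z∈) → m-max z∈ }
  ...   | inj₂ m≺x = x , here refl , λ
    { (here refl) → inj₁ refl
    ; (there z∈)  → inj₂ (≼-≺-trans (All.lookup pys z∈) (All.lookup pys m∈) px (m-max z∈) m≺x)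
    }

  ≼⇒≤ : (f : A → ℕ) → (∀ x y → P x → P y → f x < f y → x ≺ y) →
        ∀ {x y} → P x → P y → x ≼ y → f x ≤ f y
  ≼⇒≤ f ≺-extends-< px py x≼y =
    ≮⇒≥ λ fy<fx → irrefl px (≼-≺-trans px py px x≼y (≺-extends-< _ _ py px fy<fx))

^-distribʳ-* : ∀ m n o → (m * n) ^ o ≡ m ^ o * n ^ o
^-distribʳ-* m n zero    = refl
^-distribʳ-* m n (suc o) = begin
  m * n * (m * n) ^ o     ≡⟨ cong (m * n *_) (^-distribʳ-* m n o) ⟩
  m * n * (m ^ o * n ^ o) ≡⟨ interchange m n (m ^ o) (n ^ o) ⟩
  m * m ^ o * (n * n ^ o) ∎
  where open ≡-Reasoning

3^n*4^k<4^n : ∀ {k n} → 5 * k < n → 3 ^ n * 4 ^ k < 4 ^ n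
3^n*4^k<4^n {k} 5k<n with j , refl ← m≤n⇒∃[o]m+o≡n 5k<n = begin-strict
  3 * 3 ^ (5 * k + j) * 4 ^ k       ≡⟨ cong (λ x → 3 * x * 4 ^ k) (^-distribˡ-+-* 3 (5 * k) j) ⟩
  3 * (3 ^ (5 * k) * 3 ^ j) * 4 ^ k ≡⟨ regroup (3 ^ (5 * k)) (3 ^ j) (4 ^ k) ⟩
  3 ^ (5 * k) * 4 ^ k * 3 ^ suc j   ≡⟨ cong (λ x → x * 4 ^ k * 3 ^ suc j) (sym (^-*-assoc 3 5 k)) ⟩
  (3 ^ 5) ^ k * 4 ^ k * 3 ^ suc j   ≡⟨ cong (_* (3 * 3 ^ j)) (sym (^-distribʳ-* (3 ^ 5) 4 k)) ⟩
  (3 ^ 5 * 4) ^ k * 3 ^ suc j       ≤⟨ *-monoˡ-≤ (3 ^ suc j) (^-monoˡ-≤ k (≤ᵇ⇒≤ (3 ^ 5 * 4) (4 ^ 5) _)) ⟩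
  (4 ^ 5) ^ k * 3 ^ suc j           <⟨ *-monoʳ-< ((4 ^ 5) ^ k) {{m^n≢0 (4 ^ 5) k}} (^-monoˡ-< (suc j) (≤-refl {4})) ⟩
  (4 ^ 5) ^ k * 4 ^ suc j           ≡⟨ cong (_* 4 ^ suc j) (^-*-assoc 4 5 k) ⟩
  4 ^ (5 * k) * (4 * 4 ^ j)         ≡⟨ x∙yz≈y∙xz (4 ^ (5 * k)) 4 (4 ^ j) ⟩
  4 * (4 ^ (5 * k) * 4 ^ j)         ≡⟨ cong (4 *_) (sym (^-distribˡ-+-* 4 (5 * k) j)) ⟩
  4 * 4 ^ (5 * k + j)               ∎
  where
  open ≤-Reasoning
  regroup : ∀ a b c → 3 * (a * b) * c ≡ a * c * (3 * b)
  regroup = solve-∀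

4^n≤3^n*4^k⇒n≤5k : ∀ {n k} → 4 ^ n ≤ 3 ^ n * 4 ^ k → n ≤ 5 * k
4^n≤3^n*4^k⇒n≤5k {n} {k} 4^n≤ = ≮⇒≥ λ 5k<n → <⇒≱ (3^n*4^k<4^n {k} {n} 5k<n) 4^n≤

allConcepts : ∀ n → List (Concept n)
allConcepts zero    = [ [] ]
allConcepts (suc n) = cartesianProductWith _∷_ (true ∷ false ∷ []) (allConcepts n)

allConcepts-unique : ∀ n → Unique (allConcepts n)
allConcepts-unique zero    = [] ∷ []
allConcepts-unique (suc n) =
  cartesianProductWith⁺ _∷_ Vec.∷-injective (((λ ()) ∷ []) ∷ [] ∷ []) (allConcepts-unique n)

length-allConcepts : ∀ n → length (allConcepts n) ≡ 2 ^ n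
length-allConcepts zero    = refl
length-allConcepts (suc n) =
  trans (length-cartesianProductWith _∷_ (true ∷ false ∷ []) (allConcepts n))
        (cong (2 *_) (length-allConcepts n))

realizableOfSize≤ : ∀ n → ℕ → List (Sample n)
realizableOfSize≤ zero    _       = [ [] ]
realizableOfSize≤ (suc n) zero    = map ((false , false) ∷_) (realizableOfSize≤ n zero)
realizableOfSize≤ (suc n) (suc k) =
  map ((false , false) ∷_) (realizableOfSize≤ n (suc k)) ++
  map ((true  , false) ∷_) (realizableOfSize≤ n k) ++
  map ((false , true)  ∷_) (realizableOfSize≤ n k)

Consistent-tail : ∀ {n b p} {c : Concept n} {S : Sample n} → Consistent (b ∷ c) (p ∷ S) → Consistent c S
Consistent-tail c⊨S x false = c⊨S (suc x) false
Consistent-tail c⊨S x true  = c⊨S (suc x) true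

Realizable-tail : ∀ {n p} {S : Sample n} → Realizable (p ∷ S) → Realizable S
Realizable-tail (_ ∷ c , c⊨S) = c , Consistent-tail c⊨S

¬Realizable-both-labels : ∀ {n} {S : Sample n} → ¬ Realizable ((true , true) ∷ S)
¬Realizable-both-labels (_ , c⊨S) with () ← trans (sym (c⊨S zero false refl)) (c⊨S zero true refl)

∈-realizableOfSize≤ : ∀ {n} k {S : Sample n} → Realizable S → size S ≤ k → S ∈ realizableOfSize≤ n k
∈-realizableOfSize≤ _ {[]} _ _ = here refl
∈-realizableOfSize≤ zero {(false , false) ∷ _} r S≤k =
  ∈-map⁺ _ (∈-realizableOfSize≤ zero (Realizable-tail r) S≤k)
∈-realizableOfSize≤ (suc k) {(false , false) ∷ _} r S≤k =
  ∈-++⁺ˡ (∈-map⁺ _ (∈-realizableOfSize≤ (suc k) (Realizable-tail r) S≤k))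
∈-realizableOfSize≤ {suc n} (suc k) {(true , false) ∷ _} r S≤k =
  ∈-++⁺ʳ (map _ (realizableOfSize≤ n (suc k)))
    (∈-++⁺ˡ (∈-map⁺ _ (∈-realizableOfSize≤ k (Realizable-tail r) (s≤s⁻¹ S≤k))))
∈-realizableOfSize≤ {suc n} (suc k) {(false , true) ∷ _} r S≤k =
  ∈-++⁺ʳ (map _ (realizableOfSize≤ n (suc k))) (∈-++⁺ʳ (map _ (realizableOfSize≤ n k))
    (∈-map⁺ _ (∈-realizableOfSize≤ k (Realizable-tail r) (s≤s⁻¹ S≤k))))
∈-realizableOfSize≤ _ {(true , true) ∷ _} r _ = contradiction r ¬Realizable-both-labels

-- The sum over i ≤ k of C(n,i) 2^i is at most the sum over all i of C(n,i) 2^i 4^(k-i),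
-- which is 4^k (3/2)^n.
length-realizableOfSize≤ : ∀ n k → length (realizableOfSize≤ n k) * 2 ^ n ≤ 3 ^ n * 4 ^ k
length-realizableOfSize≤ zero    k    = ≤-trans (m^n>0 4 k) (m≤m+n (4 ^ k) 0)
length-realizableOfSize≤ (suc n) zero = begin
  length (map _ (realizableOfSize≤ n zero)) * (2 * 2 ^ n)
    ≡⟨ cong (_* (2 * 2 ^ n)) (length-map _ (realizableOfSize≤ n zero)) ⟩
  length (realizableOfSize≤ n zero) * (2 * 2 ^ n)
    ≡⟨ x∙yz≈y∙xz (length (realizableOfSize≤ n zero)) 2 (2 ^ n) ⟩
  2 * (length (realizableOfSize≤ n zero) * 2 ^ n)
    ≤⟨ *-mono-≤ (≤ᵇ⇒≤ 2 3 _) (length-realizableOfSize≤ n zero) ⟩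
  3 * (3 ^ n * 1)
    ≡⟨ sym (*-assoc 3 (3 ^ n) 1) ⟩
  3 * 3 ^ n * 1 ∎
  where open ≤-Reasoning
length-realizableOfSize≤ (suc n) (suc k) = begin
  length (realizableOfSize≤ (suc n) (suc k)) * (2 * 2 ^ n)
    ≡⟨ cong (_* (2 * 2 ^ n)) length-split ⟩
  (a + (b + b)) * (2 * 2 ^ n)
    ≡⟨ regroup a b (2 ^ n) ⟩
  2 * (a * 2 ^ n) + 4 * (b * 2 ^ n)
    ≤⟨ +-mono-≤ (*-monoʳ-≤ 2 (length-realizableOfSize≤ n (suc k)))
                (*-monoʳ-≤ 4 (length-realizableOfSize≤ n k)) ⟩
  2 * (3 ^ n * (4 * 4 ^ k)) + 4 * (3 ^ n * 4 ^ k)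
    ≡⟨ collect (3 ^ n) (4 ^ k) ⟩
  3 * 3 ^ n * (4 * 4 ^ k) ∎
  where
  open ≤-Reasoning
  a = length (realizableOfSize≤ n (suc k))
  b = length (realizableOfSize≤ n k)
  length-split : length (realizableOfSize≤ (suc n) (suc k)) ≡ a + (b + b)
  length-split = trans (length-map-++ _ (realizableOfSize≤ n (suc k)) _) (cong (a +_)
    (trans (length-map-++ _ (realizableOfSize≤ n k) _) (cong (b +_) (length-map _ (realizableOfSize≤ n k)))))
  regroup : ∀ a b x → (a + (b + b)) * (2 * x) ≡ 2 * (a * x) + 4 * (b * x)
  regroup = solve-∀
  collect : ∀ x y → 2 * (x * (4 * y)) + 4 * (x * y) ≡ 3 * x * (4 * y)
  collect = solve-∀

2^n≤length-realizableOfSize≤⇒n≤5k : ∀ {n k} → 2 ^ n ≤ length (realizableOfSize≤ n k) → n ≤ 5 * k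
2^n≤length-realizableOfSize≤⇒n≤5k {n} {k} 2^n≤ = 4^n≤3^n*4^k⇒n≤5k {k = k} (begin
  4 ^ n                                  ≡⟨ ^-distribʳ-* 2 2 n ⟩
  2 ^ n * 2 ^ n                          ≤⟨ *-monoˡ-≤ (2 ^ n) 2^n≤ ⟩
  length (realizableOfSize≤ n k) * 2 ^ n ≤⟨ length-realizableOfSize≤ n k ⟩
  3 ^ n * 4 ^ k                          ∎)
  where open ≤-Reasoning

fullSample : ∀ {n} → Concept n → Sample n
fullSample []      = []
fullSample (b ∷ c) = (not b , b) ∷ fullSample c

fullSample-consistent : ∀ {n} (c : Concept n) → Consistent c (fullSample c)
fullSample-consistent (false ∷ c) zero    false _   = refl
fullSample-consistent (b ∷ c)     zero    true  b≡t = b≡t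
fullSample-consistent (b ∷ c)     (suc x) false x∈S = fullSample-consistent c x false x∈S
fullSample-consistent (b ∷ c)     (suc x) true  x∈S = fullSample-consistent c x true x∈S

fullSample-determines : ∀ {n} {c c′ : Concept n} → Consistent c′ (fullSample c) → c′ ≡ c
fullSample-determines {c = []}    {[]}     _      = refl
fullSample-determines {c = _ ∷ _} {_ ∷ _} c′⊨S =
  cong₂ _∷_ (head-determined c′⊨S) (fullSample-determines (Consistent-tail c′⊨S))
  where
  head-determined : ∀ {n b b′} {c c′ : Concept n} → Consistent (b′ ∷ c′) (fullSample (b ∷ c)) → b′ ≡ b
  head-determined {b = true}  c′⊨S = c′⊨S zero true refl
  head-determined {b = false} c′⊨S = c′⊨S zero false refl

module GreedyCost {n : ℕ}
  (_≺c_ : Concept n → Concept n → Set)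
  (_≺s_ : Sample n → Sample n → Set) where
  open Greedy _≺c_ _≺s_

  concepts : Matching n → List (Concept n)
  concepts = map proj₁

  samples : Matching n → List (Sample n)
  samples = map proj₂

  CMatched⇒∈ : ∀ {M c} → CMatched M c → c ∈ concepts M
  CMatched⇒∈ = Any.map sym ∘ map⁺

  SMatched⇒∈ : ∀ {M S} → SMatched M S → S ∈ samples M
  SMatched⇒∈ = Any.map sym ∘ map⁺

  ∈⇒SMatched : ∀ {M S} → S ∈ samples M → SMatched M S
  ∈⇒SMatched = map⁻ ∘ Any.map sym

  record WellFormed (M : Matching n) : Set where
    field
      consistent     : All (uncurry Consistent) M
      samples-unique : Unique (samples M)
  open WellFormed

  steps-wellFormed : ∀ {M M′} → Star Step M M′ → WellFormed M → WellFormed M′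
  steps-wellFormed ε wf = wf
  steps-wellFormed (step c S _ _ S-unmatched c⊨S _ ◅ steps) wf = steps-wellFormed steps record
    { consistent     = c⊨S ∷ consistent wf
    ; samples-unique = All.¬Any⇒All¬ _ (S-unmatched ∘ ∈⇒SMatched) ∷ samples-unique wf
    }

  samples-realizable : ∀ {M} → WellFormed M → All Realizable (samples M)
  samples-realizable wf = All.map⁺ (All.map (λ {(c , _)} c⊨S → c , c⊨S) (consistent wf))

  fullSample-matched⇒matched : ∀ {M c} → WellFormed M → SMatched M (fullSample c) → CMatched M c
  fullSample-matched⇒matched wf S-matched with (c′ , S) , e∈M , refl ← find S-matched =
    lose e∈M (fullSample-determines (All.lookup (consistent wf) e∈M))

  maximal⇒all-matched : ∀ {M} → WellFormed M → Maximal M → ∀ c → CMatched M c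
  maximal⇒all-matched {M} wf maximal c =
    decidable-stable (any? (λ e → Vec.≡-dec Bool._≟_ (proj₁ e) c) M) λ c-unmatched →
      maximal c (fullSample c) c-unmatched
        (c-unmatched ∘ fullSample-matched⇒matched wf) (fullSample-consistent c)

  all-matched⇒2^n≤length : ∀ {M} → (∀ c → CMatched M c) → 2 ^ n ≤ length M
  all-matched⇒2^n≤length {M} all-matched = begin
    2 ^ n                  ≡⟨ sym (length-allConcepts n) ⟩
    length (allConcepts n) ≤⟨ unique∧⊆⇒length≤ (allConcepts-unique n) (λ {c} _ → CMatched⇒∈ (all-matched c)) ⟩
    length (concepts M)    ≡⟨ length-map proj₁ M ⟩
    length M               ∎
    where open ≤-Reasoning

  wellFormed⇒length≤ : ∀ {M Ss} → WellFormed M → samples M ⊆ Ss → length M ≤ length Ss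
  wellFormed⇒length≤ {M} wf M⊆Ss =
    subst (_≤ _) (length-map proj₂ M) (unique∧⊆⇒length≤ (samples-unique wf) M⊆Ss)

  module _ (≺s-linear : LinearOrderOn Realizable _≺s_) where

    leastPreferred : ∀ {M c} → WellFormed M → CMatched M c → ∃ (LeastPreferredMatched M)
    leastPreferred {(_ , S₀) ∷ M} wf _
      with S , S∈ , S-max ← greatest ≺s-linear (Vec.≡-dec (Product.≡-dec Bool._≟_ Bool._≟_))
                              S₀ (samples M) (samples-realizable wf) =
      S , ∈⇒SMatched S∈ , λ S′ S′-matched → S-max (SMatched⇒∈ S′-matched)

    greedy-cost : (∀ S S′ → Realizable S → Realizable S′ → size S < size S′ → S ≺s S′) →
                  ∀ M → GreedyMatching M → ∃ λ S → LeastPreferredMatched M S × n ≤ 5 * size S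
    greedy-cost ≺s-extends-< M (reachable , maximal) =
      S , S-least , 2^n≤length-realizableOfSize≤⇒n≤5k
        (≤-trans (all-matched⇒2^n≤length all-matched) (wellFormed⇒length≤ wf samples-small))
      where
      wf : WellFormed M
      wf = steps-wellFormed reachable record { consistent = [] ; samples-unique = [] }
      all-matched : ∀ c → CMatched M c
      all-matched = maximal⇒all-matched wf maximal
      realizable : ∀ {S} → S ∈ samples M → Realizable S
      realizable = All.lookup (samples-realizable wf)
      least : ∃ (LeastPreferredMatched M)
      least = leastPreferred wf (all-matched (replicate n false))
      S : Sample n
      S = proj₁ least
      S-least : LeastPreferredMatched M S
      S-least = proj₂ least
      samples-small : samples M ⊆ realizableOfSize≤ n (size S)
      samples-small S′∈ = ∈-realizableOfSize≤ (size S) (realizable S′∈)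
        (≼⇒≤ ≺s-linear size ≺s-extends-< (realizable S′∈) (realizable (SMatched⇒∈ (proj₁ S-least)))
          (proj₂ S-least _ (∈⇒SMatched S′∈)))

theorem4 : ∃ λ p → ∃ λ q → 0 < p × 0 < q ×
    (∀ (n : ℕ)
       (_≺c_ : Concept n → Concept n → Set)
       (_≺s_ : Sample n → Sample n → Set) →
       LinearOrderOn {Concept n} (λ _ → ⊤) _≺c_ →
       LinearOrderOn {Sample n} Realizable _≺s_ →
       (∀ S S′ → Realizable S → Realizable S′ → size S < size S′ → S ≺s S′) →
       (M : Matching n) → Greedy.GreedyMatching _≺c_ _≺s_ M →
       ∃ λ S → Greedy.LeastPreferredMatched _≺c_ _≺s_ M S × p * n ≤ q * size S)
theorem4 = 1 , 5 , z<s , z<s , λ n _≺c_ _≺s_ _ ≺s-linear ≺s-extends-< M greedy →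
  let S , S-least , n≤5k = GreedyCost.greedy-cost _≺c_ _≺s_ ≺s-linear ≺s-extends-< M greedy
  in  S , S-least , subst (_≤ 5 * size S) (sym (*-identityˡ n)) n≤5k
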